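{- Let $(V,\mathcal{B})$ be a $(v,k,1)$-BIBD with well-distributed minimal sub-BIBDs, whose minimal sub-BIBDs are $(v',k,1)$-BIBDs, and let $\mathcal{D}$ be the collection of minimal sub-BIBDs (as point sets). For distinct $D_{1},D_{2}\in\mathcal{D}$ and a triple $(x_{1},x_{2},x_{3})$ let $N_{D_{1}D_{2}}(x_{1},x_{2},x_{3})$ be the number of $D\in\mathcal{D}\setminus\{D_{1},D_{2}\}$ with $|D\cap(D_{1}\setminus D_{2})|=x_{1}$, $|D\cap D_{1}\cap D_{2}|=x_{2}$, $|D\cap(D_{2}\setminus D_{1})|=x_{3}$. Then: for any $D_{1},D_{2}\in\mathcal{D}$ with $|D_{1}\cap D_{2}|=1$, $$N_{D_{1}D_{2}}(k,0,k)\leq\frac{(v'-1)(v'-k)}{k(k-1)}\left\lfloor\frac{v'-1}{k}\right\rfloor,\quad N_{D_{1}D_{2}}(k-1,1,k-1)\leq\frac{(v'-1)^{2}}{(k-1)^{2}},\quad N_{D_{1}D_{2}}(k,0,1)\leq\frac{(v'-1)^{2}(v'-k)}{k(k-1)};$$ for any $D_{1},D_{2}\in\mathcal{D}$ with $|D_{1}\cap D_{2}|=k$, $$N_{D_{1}D_{2}}(k,0,k)\leq\frac{(v'-k^{2}+k-1)(v'-k)}{k(k-1)}\left\lfloor\frac{v'-k}{k}\right\rfloor,\quad N_{D_{1}D_{2}}(k-1,1,k-1)\leq\frac{k(v'-k)^{2}}{(k-1)^{2}},\quad N_{D_{1}D_{2}}(k,0,1)\leq\frac{(v'-k^{2}+k-1)(v'-k)^{2}}{k(k-1)};$$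 for any $D_{1},D_{2}\in\mathcal{D}$ with $D_{1}\cap D_{2}=\emptyset$, $$N_{D_{1}D_{2}}(k,0,k)\leq\frac{v'(v'-1)}{k(k-1)}\left\lfloor\frac{v'}{k}\right\rfloor,\quad N_{D_{1}D_{2}}(k,0,1)\leq\frac{v'^{2}(v'-1)}{k(k-1)}.$$ In particular the same bounds hold for the averages of these quantities over all ordered pairs $(D_{1},D_{2})$ of distinct members of $\mathcal{D}$ with the given intersection size.
   Context: A $(v,k,\lambda)$-BIBD is a pair $(V,\mathcal{B})$ where $V$ is a finite set of $v$ points and $\mathcal{B}$ is a set (no repeated blocks) of $k$-subsets of $V$, $k>1$, such that every pair of distinct points lies in exactly $\lambda$ blocks; trivial cases are excluded. A sub-BIBD of a $(v,k,1)$-BIBD $(V,\mathcal{B})$ is a pair $(V',\mathcal{B}')$ with $V'\subseteq V$, $\mathcal{B}'\subseteq\{B\in\mathcal{B}:B\subseteq V'\}$, which is itself a $(v',k,1)$-BIBD. A sub-BIBD is minimal if $v'$ is minimal among all sub-BIBDs with $v'>k$. $(V,\mathcal{B})$ has well-distributed minimal sub-BIBDs if there are integers $l,m$ such that every point lies in exactly $l$ minimal sub-BIBDs and every block lies in exactly $m$ minimal sub-BIBDs. -}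

module Defs where

open import Data.Nat as ℕ using (ℕ; zero; suc; _<_; _≤_; _/_)
open import Data.Integer as ℤ using (ℤ; +_)
open import Data.Fin using (Fin)
open import Data.Fin.Subset as SS using (Subset; ∣_∣; _∩_; _─_; _⊆_)
open import Data.Fin.Subset.Properties using (_∈?_; _⊆?_)
open import Data.Bool using (_≟_)
open import Data.Vec.Properties using (≡-dec)
open import Data.List using (List; length; filter; map; concatMap)
open import Data.Nat.ListAction using (sum)
open import Data.List.Membership.Propositional as LM using ()
open import Data.List.Relation.Unary.All using (All)
open import Data.List.Relation.Unary.Unique.Propositional using (Unique)
open import Data.Product using (Σ; _×_; _,_; proj₁; proj₂)
open import Relation.Nullary using (¬_; Dec)
open import Relation.Nullary.Decidable using (_×-dec_; ¬?)
open import Relation.Binary.PropositionalEquality using (_≡_; _≢_)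
open import Function.Bundles using (_⇔_)

_≟S_ : ∀ {v} (p q : Subset v) → Dec (p ≡ q)
_≟S_ = ≡-dec _≟_

count : ∀ {A : Set} {P : A → Set} → (∀ a → Dec (P a)) → List A → ℕ
count P? xs = length (filter P? xs)

-- (|P|, k, λ)-BIBD on the point set P ⊆ Fin v with block list Bs.
record IsBIBD {v : ℕ} (P : Subset v) (Bs : List (Subset v)) (k lam : ℕ) : Set where
  field
    noRepeat   : Unique Bs
    blockSize  : All (λ B → ∣ B ∣ ≡ k) Bs
    blockInP   : All (λ B → B ⊆ P) Bs
    pairCount  : ∀ (x y : Fin v) → x SS.∈ P → y SS.∈ P → x ≢ y →
                 count (λ B → (x ∈? B) ×-dec (y ∈? B)) Bs ≡ lam
    k>1        : 1 < k
    nontrivial : k < ∣ P ∣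

IsSubBIBD : ∀ {v} → List (Subset v) → ℕ → Subset v → Set
IsSubBIBD Bs k S =
  Σ (List (Subset _)) λ B' → All (LM._∈ Bs) B' × IsBIBD S B' k 1

IsMinimalSubBIBD : ∀ {v} → List (Subset v) → ℕ → Subset v → Set
IsMinimalSubBIBD Bs k S =
  IsSubBIBD Bs k S × k < ∣ S ∣ ×
  (∀ S' → IsSubBIBD Bs k S' → k < ∣ S' ∣ → ∣ S ∣ ≤ ∣ S' ∣)

IsMinimalCollection : ∀ {v} → List (Subset v) → ℕ → List (Subset v) → Set
IsMinimalCollection Bs k 𝒟 =
  Unique 𝒟 × (∀ S → (S LM.∈ 𝒟) ⇔ IsMinimalSubBIBD Bs k S)

-- Well-distributed minimal sub-BIBDs: every point lies in exactly l, every
-- block lies in exactly m minimal sub-BIBDs (a block lies in the minimal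
-- sub-BIBD on S iff it is contained in S, since λ = 1).
WellDistributed : ∀ {v} → List (Subset v) → List (Subset v) → Set
WellDistributed {v} Bs 𝒟 =
  Σ ℕ λ l → Σ ℕ λ m →
    (∀ (x : Fin v) → count (x ∈?_) 𝒟 ≡ l) ×
    (∀ B → B LM.∈ Bs → count (B ⊆?_) 𝒟 ≡ m)

N : ∀ {v} → List (Subset v) → Subset v → Subset v → ℕ → ℕ → ℕ → ℕ
N 𝒟 D₁ D₂ x₁ x₂ x₃ =
  count (λ D → ¬? (D ≟S D₁) ×-dec ¬? (D ≟S D₂) ×-dec
               (∣ D ∩ (D₁ ─ D₂) ∣ ℕ.≟ x₁) ×-dec
               (∣ D ∩ (D₁ ∩ D₂) ∣ ℕ.≟ x₂) ×-dec
               (∣ D ∩ (D₂ ─ D₁) ∣ ℕ.≟ x₃)) 𝒟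

-- floor (m / k), (only used with k ≥ 2; value at k = 0 is irrelevant)
flr : ℕ → ℕ → ℕ
flr m zero    = 0
flr m (suc k) = m / suc k

-- "n ≤ num / den" for den > 0, cross-multiplied (exact over ℤ).
BoundedBy : ℕ → ℤ → ℕ → Set
BoundedBy n num den = (+ n) ℤ.* (+ den) ℤ.≤ num

pairsWith : ∀ {v} → List (Subset v) → ℕ → List (Subset v × Subset v)
pairsWith 𝒟 c =
  filter (λ p → ¬? (proj₁ p ≟S proj₂ p) ×-dec (∣ proj₁ p ∩ proj₂ p ∣ ℕ.≟ c))
         (concatMap (λ D₁ → map (λ D₂ → (D₁ , D₂)) 𝒟) 𝒟)

-- The bound N_{D1D2}(x1,x2,x3) ≤ num/den for all distinct D1,D2 ∈ 𝒟 with
-- |D1 ∩ D2| = c, together with the same bound for the average over all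
-- ordered pairs of distinct members with |D1 ∩ D2| = c (average written as
-- (sum of N) ≤ (number of pairs) * num/den, meaningful also when there are
-- no such pairs).
BoundFor : ∀ {v} → List (Subset v) → ℕ → ℕ → ℕ → ℕ → ℤ → ℕ → Set
BoundFor 𝒟 c x₁ x₂ x₃ num den =
  (∀ D₁ D₂ → D₁ LM.∈ 𝒟 → D₂ LM.∈ 𝒟 → D₁ ≢ D₂ → ∣ D₁ ∩ D₂ ∣ ≡ c →
     BoundedBy (N 𝒟 D₁ D₂ x₁ x₂ x₃) num den)
  ×
  ((+ sum (map (λ p → N 𝒟 (proj₁ p) (proj₂ p) x₁ x₂ x₃) (pairsWith 𝒟 c)))
      ℤ.* (+ den)
    ℤ.≤ (+ length (pairsWith 𝒟 c)) ℤ.* num)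

module Submission where

-- Write A = D₁ ─ D₂, I = D₁ ∩ D₂, C = D₂ ─ D₁, with ∣ I ∣ = c and ∣ A ∣ = ∣ C ∣ = v′ ∸ c. As λ = 1,
-- two points span a unique block, their line. The point set of a sub-BIBD is closed under lines,
-- and a closed set with more than k points carries a sub-BIBD; so two minimal sub-BIBDs sharing
-- three non-collinear points meet in a sub-BIBD and, by minimality, coincide. Every bound is then
-- a double count: a member of 𝒟 with the given profile contains a fixed number of tuples of
-- points (ordered pairs in A, triples in A × A × C or in I × A × C); these tuples lie in a region
-- of bounded size; and each tuple lies in at most one such member (at most ⌊ ∣ C ∣ / k ⌋ for
-- pairs). For pairs the region is bounded by looking from a point x ∈ A: the lines from x to the
-- c points of I are distinct, so at most g = v′ ∸ (c * (k ∸ 1) + 1) points y of D₁ see x along a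
-- line missing I.

module Counting where

  open import Data.Nat using (ℕ; suc; _+_; _*_; _≤_; z≤n; s≤s)
  open import Data.Nat.Properties
  open import Data.Nat.ListAction using (sum)
  open import Data.Nat.ListAction.Properties using (sum-++)
  open import Data.Bool using (true; false; if_then_else_)
  open import Data.List using (List; []; _∷_; map; filter; length; cartesianProduct)
  open import Data.List.Properties using (map-++; map-∘; filter-≐; filter-none; filter-some)
  open import Data.List.Membership.Propositional using (_∈_)
  open import Data.List.Relation.Unary.Any using (here; there)
  import Data.List.Relation.Unary.Any as Any
  import Data.List.Relation.Unary.All as All
  open import Data.List.Relation.Unary.Unique.Propositional using (Unique; _∷_)
  open import Data.Product using (_×_; _,_; proj₁; proj₂; ∃)
  import Data.Product
  open import Function using (_∘_)
  open import Relation.Nullary using (Dec; yes; no; does; ¬_; contradiction)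
  open import Relation.Nullary.Decidable using (_×-dec_; ¬?)
  open import Relation.Unary using (Decidable; _≐_)
  open import Relation.Binary.PropositionalEquality
  open import Algebra.Properties.CommutativeSemigroup +-commutativeSemigroup using (interchange)
  open import Defs using (count)

  private variable
    A B X Y : Set

  ∑ : List A → (A → ℕ) → ℕ
  ∑ xs f = sum (map f xs)

  𝟙 : Dec X → ℕ
  𝟙 d = if does d then 1 else 0

  ∑-cong : (xs : List A) {f g : A → ℕ} → (∀ {a} → a ∈ xs → f a ≡ g a) → ∑ xs f ≡ ∑ xs g
  ∑-cong []       f≡g = refl
  ∑-cong (x ∷ xs) f≡g = cong₂ _+_ (f≡g (here refl)) (∑-cong xs (f≡g ∘ there))

  ∑-mono : (xs : List A) {f g : A → ℕ} → (∀ {a} → a ∈ xs → f a ≤ g a) → ∑ xs f ≤ ∑ xs g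
  ∑-mono []       f≤g = z≤n
  ∑-mono (x ∷ xs) f≤g = +-mono-≤ (f≤g (here refl)) (∑-mono xs (f≤g ∘ there))

  ∑-zero : (xs : List A) → ∑ xs (λ _ → 0) ≡ 0
  ∑-zero []       = refl
  ∑-zero (x ∷ xs) = ∑-zero xs

  ∑-+ : (xs : List A) (f g : A → ℕ) → ∑ xs (λ a → f a + g a) ≡ ∑ xs f + ∑ xs g
  ∑-+ []       f g = refl
  ∑-+ (x ∷ xs) f g =
    trans (cong (f x + g x +_) (∑-+ xs f g)) (interchange (f x) (g x) (∑ xs f) (∑ xs g))

  ∑-*ʳ : (xs : List A) (f : A → ℕ) (c : ℕ) → ∑ xs (λ a → f a * c) ≡ ∑ xs f * c
  ∑-*ʳ []       f c = refl
  ∑-*ʳ (x ∷ xs) f c =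
    trans (cong (f x * c +_) (∑-*ʳ xs f c)) (sym (*-distribʳ-+ c (f x) (∑ xs f)))

  ∑-swap : (xs : List A) (ys : List B) (f : A → B → ℕ) →
           ∑ xs (λ a → ∑ ys (f a)) ≡ ∑ ys (λ b → ∑ xs (λ a → f a b))
  ∑-swap []       ys f = sym (∑-zero ys)
  ∑-swap (x ∷ xs) ys f =
    trans (cong (∑ ys (f x) +_) (∑-swap xs ys f)) (sym (∑-+ ys (f x) _))

  ∑-⊗ : (xs : List A) (ys : List B) (f : A × B → ℕ) →
        ∑ (cartesianProduct xs ys) f ≡ ∑ xs (λ a → ∑ ys (λ b → f (a , b)))
  ∑-⊗ []       ys f = refl
  ∑-⊗ (x ∷ xs) ys f = begin
    sum (map f (map (x ,_) ys ++ cartesianProduct xs ys))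
      ≡⟨ cong sum (map-++ f (map (x ,_) ys) _) ⟩
    sum (map f (map (x ,_) ys) ++ map f (cartesianProduct xs ys))
      ≡⟨ sum-++ (map f (map (x ,_) ys)) _ ⟩
    sum (map f (map (x ,_) ys)) + ∑ (cartesianProduct xs ys) f
      ≡⟨ cong₂ _+_ (cong sum (sym (map-∘ ys))) (∑-⊗ xs ys f) ⟩
    ∑ ys (λ b → f (x , b)) + ∑ xs (λ a → ∑ ys (λ b → f (a , b))) ∎
    where open ≡-Reasoning
          open import Data.List using (_++_)

  module _ {P : A → Set} (P? : Decidable P) where

    count≡∑ : (xs : List A) → count P? xs ≡ ∑ xs (𝟙 ∘ P?)
    count≡∑ []       = refl
    count≡∑ (x ∷ xs) with does (P? x)
    ... | true  = cong suc (count≡∑ xs)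
    ... | false = count≡∑ xs

    count-none : (xs : List A) → (∀ {a} → a ∈ xs → ¬ P a) → count P? xs ≡ 0
    count-none xs none = cong length (filter-none P? (All.tabulate none))

    count-≤1 : (xs : List A) → Unique xs →
               (∀ {a b} → a ∈ xs → b ∈ xs → P a → P b → a ≡ b) → count P? xs ≤ 1
    count-≤1 []       _            _    = z≤n
    count-≤1 (x ∷ xs) (x∉xs ∷ uniq) same with P? x
    ... | yes px = s≤s (≤-reflexive (count-none xs λ a∈xs pa →
                     All.lookup x∉xs a∈xs (same (here refl) (there a∈xs) px pa)))
    ... | no  _  = count-≤1 xs uniq (λ a∈ b∈ → same (there a∈) (there b∈))

    count-pos : (xs : List A) {a : A} → a ∈ xs → P a → 1 ≤ count P? xs
    count-pos xs a∈xs pa = filter-some P? (Any.map (λ { refl → pa }) a∈xs)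

  count-cong : {P Q : A → Set} (P? : Decidable P) (Q? : Decidable Q) (xs : List A) →
               P ≐ Q → count P? xs ≡ count Q? xs
  count-cong P? Q? xs P≐Q = cong length (filter-≐ P? Q? P≐Q xs)

  count-map : {P : B → Set} (P? : Decidable P) (f : A → B) (xs : List A) →
              count P? (map f xs) ≡ count (P? ∘ f) xs
  count-map P? f []       = refl
  count-map P? f (x ∷ xs) with does (P? (f x))
  ... | true  = cong suc (count-map P? f xs)
  ... | false = count-map P? f xs

  count-witness : {P : A → Set} (P? : Decidable P) (xs : List A) → 1 ≤ count P? xs → ∃ λ a → a ∈ xs × P a
  count-witness P? (x ∷ xs) pos with P? x
  ... | yes px = x , here refl , px
  ... | no  _  = Data.Product.map₂ (Data.Product.map₁ there) (count-witness P? xs pos)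

  count-filter : {P Q : A → Set} (P? : Decidable P) (Q? : Decidable Q) (xs : List A) →
                 (∀ {a} → a ∈ xs → P a → Q a) → count P? (filter Q? xs) ≡ count P? xs
  count-filter P? Q? []       P⇒Q = refl
  count-filter P? Q? (x ∷ xs) P⇒Q with Q? x
  ... | yes _ with P? x
  ...   | yes _ = cong suc (count-filter P? Q? xs (P⇒Q ∘ there))
  ...   | no  _ = count-filter P? Q? xs (P⇒Q ∘ there)
  count-filter P? Q? (x ∷ xs) P⇒Q | no ¬q with P? x
  ...   | yes p = contradiction (P⇒Q (here refl) p) ¬q
  ...   | no  _ = count-filter P? Q? xs (P⇒Q ∘ there)

  𝟙-× : (d : Dec X) (e : Dec Y) → 𝟙 (d ×-dec e) ≡ 𝟙 d * 𝟙 e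
  𝟙-× (yes _) e = sym (+-identityʳ (𝟙 e))
  𝟙-× (no  _) e = refl

  𝟙-split : (d : Dec X) (e : Dec Y) → 𝟙 d ≡ 𝟙 (d ×-dec e) + 𝟙 (d ×-dec ¬? e)
  𝟙-split (yes _) (yes _) = refl
  𝟙-split (yes _) (no  _) = refl
  𝟙-split (no  _) e       = refl

  𝟙-*-mono : (d : Dec X) {m n : ℕ} → (X → m ≤ n) → 𝟙 d * m ≤ 𝟙 d * n
  𝟙-*-mono (yes x) m≤n = +-monoˡ-≤ 0 (m≤n x)
  𝟙-*-mono (no  _) m≤n = z≤n

  𝟙-*-cong : (d : Dec X) {m n : ℕ} → (X → m ≡ n) → 𝟙 d * m ≡ 𝟙 d * n
  𝟙-*-cong (yes x) m≡n = cong (_+ 0) (m≡n x)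
  𝟙-*-cong (no  _) m≡n = refl

  count-const× : {Q : A → Set} (d : Dec X) (Q? : Decidable Q) (xs : List A) →
                 count (λ a → d ×-dec Q? a) xs ≡ 𝟙 d * count Q? xs
  count-const× d Q? xs = begin
    count (λ a → d ×-dec Q? a) xs  ≡⟨ count≡∑ (λ a → d ×-dec Q? a) xs ⟩
    ∑ xs (λ a → 𝟙 (d ×-dec Q? a))  ≡⟨ ∑-cong xs (λ {a} _ → trans (𝟙-× d (Q? a)) (*-comm (𝟙 d) _)) ⟩
    ∑ xs (λ a → 𝟙 (Q? a) * 𝟙 d)    ≡⟨ ∑-*ʳ xs (𝟙 ∘ Q?) (𝟙 d) ⟩
    ∑ xs (𝟙 ∘ Q?) * 𝟙 d            ≡⟨ cong (_* 𝟙 d) (sym (count≡∑ Q? xs)) ⟩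
    count Q? xs * 𝟙 d              ≡⟨ *-comm (count Q? xs) (𝟙 d) ⟩
    𝟙 d * count Q? xs              ∎
    where open ≡-Reasoning

  count-split : {P Q : A → Set} (P? : Decidable P) (Q? : Decidable Q) (xs : List A) →
                count P? xs ≡ count (λ a → P? a ×-dec Q? a) xs + count (λ a → P? a ×-dec ¬? (Q? a)) xs
  count-split P? Q? xs = begin
    count P? xs
      ≡⟨ count≡∑ P? xs ⟩
    ∑ xs (𝟙 ∘ P?)
      ≡⟨ ∑-cong xs (λ {a} _ → 𝟙-split (P? a) (Q? a)) ⟩
    ∑ xs (λ a → 𝟙 (P? a ×-dec Q? a) + 𝟙 (P? a ×-dec ¬? (Q? a)))
      ≡⟨ ∑-+ xs _ _ ⟩
    ∑ xs (λ a → 𝟙 (P? a ×-dec Q? a)) + ∑ xs (λ a → 𝟙 (P? a ×-dec ¬? (Q? a)))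
      ≡⟨ sym (cong₂ _+_ (count≡∑ _ xs) (count≡∑ _ xs)) ⟩
    count (λ a → P? a ×-dec Q? a) xs + count (λ a → P? a ×-dec ¬? (Q? a)) xs ∎
    where open ≡-Reasoning

  module _ {P : A → Set} {Q : A → B → Set} (P? : Decidable P) (Q? : ∀ a → Decidable (Q a))
           (xs : List A) (ys : List B) where

    count-⊗ : count (λ p → P? (proj₁ p) ×-dec Q? (proj₁ p) (proj₂ p)) (cartesianProduct xs ys)
              ≡ ∑ xs (λ a → 𝟙 (P? a) * count (Q? a) ys)
    count-⊗ = begin
      count (λ p → P? (proj₁ p) ×-dec Q? (proj₁ p) (proj₂ p)) (cartesianProduct xs ys)
        ≡⟨ count≡∑ _ (cartesianProduct xs ys) ⟩
      ∑ (cartesianProduct xs ys) (λ p → 𝟙 (P? (proj₁ p) ×-dec Q? (proj₁ p) (proj₂ p)))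
        ≡⟨ ∑-⊗ xs ys _ ⟩
      ∑ xs (λ a → ∑ ys (λ b → 𝟙 (P? a ×-dec Q? a b)))
        ≡⟨ ∑-cong xs (λ {a} _ → trans (sym (count≡∑ _ ys)) (count-const× (P? a) (Q? a) ys)) ⟩
      ∑ xs (λ a → 𝟙 (P? a) * count (Q? a) ys) ∎
      where open ≡-Reasoning

    count-⊗-≤ : {M : ℕ} → (∀ {a} → P a → count (Q? a) ys ≤ M) →
                count (λ p → P? (proj₁ p) ×-dec Q? (proj₁ p) (proj₂ p)) (cartesianProduct xs ys)
                ≤ count P? xs * M
    count-⊗-≤ {M} fibre≤ = begin
      count (λ p → P? (proj₁ p) ×-dec Q? (proj₁ p) (proj₂ p)) (cartesianProduct xs ys)
        ≡⟨ count-⊗ ⟩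
      ∑ xs (λ a → 𝟙 (P? a) * count (Q? a) ys)
        ≤⟨ ∑-mono xs (λ {a} _ → 𝟙-*-mono (P? a) (fibre≤ {a})) ⟩
      ∑ xs (λ a → 𝟙 (P? a) * M)
        ≡⟨ trans (∑-*ʳ xs (𝟙 ∘ P?) M) (cong (_* M) (sym (count≡∑ P? xs))) ⟩
      count P? xs * M ∎
      where open ≤-Reasoning

  count-× : {P : A → Set} {Q : B → Set} (P? : Decidable P) (Q? : Decidable Q) (xs : List A) (ys : List B) →
            count (λ p → P? (proj₁ p) ×-dec Q? (proj₂ p)) (cartesianProduct xs ys) ≡ count P? xs * count Q? ys
  count-× P? Q? xs ys =
    trans (count-⊗ P? (λ _ → Q?) xs ys)
          (trans (∑-*ʳ xs (𝟙 ∘ P?) (count Q? ys)) (cong (_* count Q? ys) (sym (count≡∑ P? xs))))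

  double-count : {P : A → Set} {W : A → B → Set} {R : B → Set}
                 (P? : Decidable P) (W? : ∀ a → Decidable (W a)) (R? : Decidable R)
                 (xs : List A) (ts : List B) {K F : ℕ} →
                 (∀ {a} → a ∈ xs → P a → count (W? a) ts ≡ K) →
                 (∀ {a t} → a ∈ xs → P a → W a t → R t) →
                 (∀ t → count (λ a → P? a ×-dec W? a t) xs ≤ F) →
                 count P? xs * K ≤ count R? ts * F
  double-count P? W? R? xs ts {K} {F} witnesses inRegion fibre≤ = begin
    count P? xs * K
      ≡⟨ trans (cong (_* K) (count≡∑ P? xs)) (sym (∑-*ʳ xs (𝟙 ∘ P?) K)) ⟩
    ∑ xs (λ a → 𝟙 (P? a) * K)
      ≡⟨ ∑-cong xs weight ⟩
    ∑ xs (λ a → ∑ ts (λ t → 𝟙 (P? a ×-dec W? a t)))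
      ≡⟨ ∑-swap xs ts _ ⟩
    ∑ ts (λ t → ∑ xs (λ a → 𝟙 (P? a ×-dec W? a t)))
      ≤⟨ ∑-mono ts (λ {t} _ → ≤-trans (≤-reflexive (sym (count≡∑ _ xs))) (fibre t)) ⟩
    ∑ ts (λ t → 𝟙 (R? t) * F)
      ≡⟨ trans (∑-*ʳ ts (𝟙 ∘ R?) F) (cong (_* F) (sym (count≡∑ R? ts))) ⟩
    count R? ts * F ∎
    where
    open ≤-Reasoning
    weight : ∀ {a} → a ∈ xs → 𝟙 (P? a) * K ≡ ∑ ts (λ t → 𝟙 (P? a ×-dec W? a t))
    weight {a} a∈xs with P? a
    ... | yes pa = trans (+-identityʳ K) (trans (sym (witnesses a∈xs pa)) (count≡∑ (W? a) ts))
    ... | no ¬pa = sym (trans (sym (count≡∑ (λ t → no ¬pa ×-dec W? a t) ts))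
                              (count-none (λ t → no ¬pa ×-dec W? a t) ts (λ _ → ¬pa ∘ proj₁)))
    fibre : ∀ t → count (λ a → P? a ×-dec W? a t) xs ≤ 𝟙 (R? t) * F
    fibre t with R? t
    ... | yes _ = ≤-trans (fibre≤ t) (≤-reflexive (sym (+-identityʳ F)))
    ... | no ¬r = ≤-reflexive (count-none _ xs (λ a∈xs (pa , w) → ¬r (inRegion a∈xs pa w)))

module Subsets where

  open import Data.Nat using (ℕ; suc; _+_; _*_; _∸_; _≤_; _<_)
  open import Data.Nat.Properties hiding (_≟_)
  open import Data.Fin using (Fin; suc; _≟_)
  open import Data.Fin.Subset using (Subset; inside; outside; _⊆_; _∩_; _─_; ∣_∣)
    renaming (_∈_ to _∈ₛ_)
  open import Data.Fin.Subset.Properties using (_∈?_; drop-there; p⊂q⇒∣p∣<∣q∣; p∩q⊆p; x∈p∩q⁻)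
  open import Data.List using (map; allFin; tabulate; cartesianProduct)
  open import Data.List.Properties using (map-tabulate)
  open import Data.List.Membership.Propositional.Properties using (∈-allFin)
  open import Data.List.Relation.Unary.Unique.Propositional.Properties using (allFin⁺)
  open import Data.Vec using ([]; _∷_)
  import Data.Vec as Vec
  open import Data.Product using (_,_; proj₁; proj₂; ∃)
  open import Function using (_∘_; id)
  open import Relation.Nullary using (yes; no; ¬_; contradiction)
  open import Relation.Nullary.Decidable using (_×-dec_; ¬?)
  open import Relation.Binary.PropositionalEquality
  open import Defs using (count)
  open Counting

  private variable
    n : ℕ

  count-suc : ∀ s (p : Subset n) → count (_∈? s ∷ p) (tabulate suc) ≡ count (_∈? p) (allFin n)
  count-suc {n} s p = begin
    count (_∈? s ∷ p) (tabulate suc)          ≡⟨ cong (count (_∈? s ∷ p)) (sym (map-tabulate id suc)) ⟩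
    count (_∈? s ∷ p) (map suc (allFin n))    ≡⟨ count-map (_∈? s ∷ p) suc (allFin n) ⟩
    count (λ i → suc i ∈? s ∷ p) (allFin n)   ≡⟨ count-cong _ _ (allFin n) (drop-there , Vec.there) ⟩
    count (_∈? p) (allFin n)                  ∎
    where open ≡-Reasoning

  ∣∣≡count : (p : Subset n) → ∣ p ∣ ≡ count (_∈? p) (allFin n)
  ∣∣≡count []            = refl
  ∣∣≡count (inside  ∷ p) = cong suc (trans (∣∣≡count p) (sym (count-suc inside p)))
  ∣∣≡count (outside ∷ p) = trans (∣∣≡count p) (sym (count-suc outside p))

  ∣p∣≡∣p∩q∣+∣p─q∣ : (p q : Subset n) → ∣ p ∣ ≡ ∣ p ∩ q ∣ + ∣ p ─ q ∣
  ∣p∣≡∣p∩q∣+∣p─q∣ []            []            = refl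
  ∣p∣≡∣p∩q∣+∣p─q∣ (inside  ∷ p) (inside  ∷ q) = cong suc (∣p∣≡∣p∩q∣+∣p─q∣ p q)
  ∣p∣≡∣p∩q∣+∣p─q∣ (inside  ∷ p) (outside ∷ q) = trans (cong suc (∣p∣≡∣p∩q∣+∣p─q∣ p q)) (sym (+-suc _ _))
  ∣p∣≡∣p∩q∣+∣p─q∣ (outside ∷ p) (inside  ∷ q) = ∣p∣≡∣p∩q∣+∣p─q∣ p q
  ∣p∣≡∣p∩q∣+∣p─q∣ (outside ∷ p) (outside ∷ q) = ∣p∣≡∣p∩q∣+∣p─q∣ p q

  count-others : {p : Subset n} {x : Fin n} → x ∈ₛ p →
                 count (λ y → (y ∈? p) ×-dec ¬? (x ≟ y)) (allFin n) ≡ ∣ p ∣ ∸ 1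
  count-others {n} {p} {x} x∈p = begin
    count others (allFin n)                         ≡⟨ sym (m+n∸m≡n 1 _) ⟩
    1 + count others (allFin n) ∸ 1                 ≡⟨ cong (λ m → m + count others (allFin n) ∸ 1) (sym itself) ⟩
    count (λ y → (y ∈? p) ×-dec (x ≟ y)) (allFin n) + count others (allFin n) ∸ 1
                                                    ≡⟨ cong (_∸ 1) (sym (count-split (_∈? p) (x ≟_) (allFin n))) ⟩
    count (_∈? p) (allFin n) ∸ 1                    ≡⟨ cong (_∸ 1) (sym (∣∣≡count p)) ⟩
    ∣ p ∣ ∸ 1                                       ∎
    where
    open ≡-Reasoning
    others = λ y → (y ∈? p) ×-dec ¬? (x ≟ y)
    itself : count (λ y → (y ∈? p) ×-dec (x ≟ y)) (allFin n) ≡ 1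
    itself = ≤-antisym
      (count-≤1 _ (allFin n) (allFin⁺ n) (λ _ _ (_ , x≡a) (_ , x≡b) → trans (sym x≡a) x≡b))
      (count-pos _ (allFin n) (∈-allFin x) (x∈p , refl))

  ordered-pairs : (p : Subset n) →
    count (λ t → (proj₁ t ∈? p) ×-dec ((proj₂ t ∈? p) ×-dec ¬? (proj₁ t ≟ proj₂ t)))
          (cartesianProduct (allFin n) (allFin n))
    ≡ ∣ p ∣ * (∣ p ∣ ∸ 1)
  ordered-pairs {n} p = begin
    _ ≡⟨ count-⊗ (_∈? p) (λ x y → (y ∈? p) ×-dec ¬? (x ≟ y)) (allFin n) (allFin n) ⟩
    ∑ (allFin n) (λ x → 𝟙 (x ∈? p) * count (λ y → (y ∈? p) ×-dec ¬? (x ≟ y)) (allFin n))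
      ≡⟨ ∑-cong (allFin n) (λ {x} _ → 𝟙-*-cong (x ∈? p) count-others) ⟩
    ∑ (allFin n) (λ x → 𝟙 (x ∈? p) * (∣ p ∣ ∸ 1))
      ≡⟨ ∑-*ʳ (allFin n) (𝟙 ∘ (_∈? p)) (∣ p ∣ ∸ 1) ⟩
    ∑ (allFin n) (𝟙 ∘ (_∈? p)) * (∣ p ∣ ∸ 1)
      ≡⟨ cong (_* (∣ p ∣ ∸ 1)) (sym (trans (∣∣≡count p) (count≡∑ (_∈? p) (allFin n)))) ⟩
    ∣ p ∣ * (∣ p ∣ ∸ 1) ∎
    where open ≡-Reasoning

  nonempty : (p : Subset n) → 0 < ∣ p ∣ → ∃ λ x → x ∈ₛ p
  nonempty {n} p pos = Data.Product.map₂ proj₂ (count-witness (_∈? p) (allFin n) (subst (1 ≤_) (∣∣≡count p) pos))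

  ∣p∣≤∣p∩q∣⇒p⊆q : (p q : Subset n) → ∣ p ∣ ≤ ∣ p ∩ q ∣ → p ⊆ q
  ∣p∣≤∣p∩q∣⇒p⊆q p q ∣p∣≤ {x} x∈p with x ∈? q
  ... | yes x∈q = x∈q
  ... | no  x∉q = contradiction ∣p∣≤
        (<⇒≱ (p⊂q⇒∣p∣<∣q∣ (p∩q⊆p p q , x , x∈p , x∉q ∘ proj₂ ∘ x∈p∩q⁻ p q)))

  x∈p─q⇒x∉q : {x : Fin n} (p q : Subset n) → x ∈ₛ p ─ q → ¬ x ∈ₛ q
  x∈p─q⇒x∉q (s ∷ p) (outside ∷ q) Vec.here        ()
  x∈p─q⇒x∉q (s ∷ p) (t ∷ q)       (Vec.there x∈) (Vec.there x∈q) = x∈p─q⇒x∉q p q x∈ x∈q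

  member⇒∣∣>0 : {p : Subset n} {x : Fin n} → x ∈ₛ p → 0 < ∣ p ∣
  member⇒∣∣>0 {n} {p} {x} x∈p = subst (0 <_) (sym (∣∣≡count p)) (count-pos (_∈? p) (allFin n) (∈-allFin x) x∈p)

module Geometry where

  open import Data.Nat using (ℕ; _<_)
  open import Data.Nat.Properties using (≤-reflexive)
  open import Data.Fin using (Fin; _≟_)
  open import Data.Fin.Subset using (Subset; ⊤; ⊥; _⊆_; _∩_; ∣_∣)
    renaming (_∈_ to _∈ₛ_; _∉_ to _∉ₛ_)
  open import Data.Fin.Subset.Properties using (_∈?_; _⊆?_; ∈⊤; x∈p∩q⁺; x∈p∩q⁻; p⊂q⇒∣p∣<∣q∣; ⊆-antisym)
  open import Data.List using (List; []; _∷_; filter)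
  open import Data.List.Membership.Propositional using (_∈_)
  open import Data.List.Membership.Propositional.Properties using (∈-filter⁻; ∈-filter⁺)
  open import Data.List.Relation.Unary.Any using (here)
  import Data.List.Relation.Unary.All as All
  import Data.List.Relation.Unary.Unique.Propositional.Properties as Unique
  open import Data.Product using (_×_; _,_; proj₁; proj₂)
  open import Function using (_∘_)
  open import Function.Bundles using (Equivalence)
  open import Relation.Nullary using (yes; no; contradiction)
  open import Relation.Nullary.Decidable using (_×-dec_)
  open import Relation.Unary using (Decidable)
  open import Relation.Binary.PropositionalEquality
  open import Defs
  open Counting
  open Subsets

  module Lines {v k : ℕ} (Bs : List (Subset v)) (design : IsBIBD ⊤ Bs k 1) where

    open IsBIBD design

    through? : (x y : Fin v) → Decidable (λ B → x ∈ₛ B × y ∈ₛ B)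
    through? x y B = (x ∈? B) ×-dec (y ∈? B)

    line : Fin v → Fin v → Subset v
    line x y with filter (through? x y) Bs
    ... | []    = ⊥
    ... | B ∷ _ = B

    -- Since λ = 1, the blocks through two distinct points are exactly their line.
    blocks-through : ∀ {x y} → x ≢ y → filter (through? x y) Bs ≡ line x y ∷ []
    blocks-through {x} {y} x≢y with filter (through? x y) Bs | pairCount x y ∈⊤ ∈⊤ x≢y
    ... | B ∷ [] | _ = refl

    line-is-block : ∀ {x y} → x ≢ y → line x y ∈ Bs × x ∈ₛ line x y × y ∈ₛ line x y
    line-is-block {x} {y} x≢y =
      ∈-filter⁻ (through? x y) (subst (line x y ∈_) (sym (blocks-through x≢y)) (here refl))

    line∈Bs : ∀ {x y} → x ≢ y → line x y ∈ Bs
    line∈Bs = proj₁ ∘ line-is-block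

    x∈line : ∀ {x y} → x ≢ y → x ∈ₛ line x y
    x∈line = proj₁ ∘ proj₂ ∘ line-is-block

    y∈line : ∀ {x y} → x ≢ y → y ∈ₛ line x y
    y∈line = proj₂ ∘ proj₂ ∘ line-is-block

    ∣line∣ : ∀ {x y} → x ≢ y → ∣ line x y ∣ ≡ k
    ∣line∣ x≢y = All.lookup blockSize (line∈Bs x≢y)

    block-is-line : ∀ {B x y} → B ∈ Bs → x ∈ₛ B → y ∈ₛ B → x ≢ y → B ≡ line x y
    block-is-line {B} {x} {y} B∈Bs x∈B y∈B x≢y
      with subst (B ∈_) (blocks-through x≢y) (∈-filter⁺ (through? x y) B∈Bs (x∈B , y∈B))
    ... | here B≡line = B≡line

    Closed : Subset v → Set
    Closed S = ∀ {x y} → x ∈ₛ S → y ∈ₛ S → x ≢ y → line x y ⊆ S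

    ∩-closed : ∀ {S T} → Closed S → Closed T → Closed (S ∩ T)
    ∩-closed {S} {T} S-closed T-closed x∈ y∈ x≢y z∈line =
      x∈p∩q⁺ ( S-closed (proj₁ (x∈p∩q⁻ S T x∈)) (proj₁ (x∈p∩q⁻ S T y∈)) x≢y z∈line
             , T-closed (proj₂ (x∈p∩q⁻ S T x∈)) (proj₂ (x∈p∩q⁻ S T y∈)) x≢y z∈line)

    -- The point set of a sub-BIBD is closed: its block through x and y must be the line.
    subBIBD-closed : ∀ {S} → IsSubBIBD Bs k S → Closed S
    subBIBD-closed {S} (B′ , B′⊆Bs , sub) {x} {y} x∈S y∈S x≢y
      with count-witness (through? x y) B′ (≤-reflexive (sym (IsBIBD.pairCount sub x y x∈S y∈S x≢y)))
    ... | B , B∈B′ , x∈B , y∈B =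
      subst (_⊆ S) (block-is-line (All.lookup B′⊆Bs B∈B′) x∈B y∈B x≢y) (All.lookup (IsBIBD.blockInP sub) B∈B′)

    -- Conversely a closed set with more than k points carries a sub-BIBD: the blocks inside it.
    closed-subBIBD : ∀ {S} → Closed S → k < ∣ S ∣ → IsSubBIBD Bs k S
    closed-subBIBD {S} S-closed k<∣S∣ = filter (_⊆? S) Bs , All.tabulate (proj₁ ∘ inside) , record
      { noRepeat   = Unique.filter⁺ (_⊆? S) noRepeat
      ; blockSize  = All.tabulate (All.lookup blockSize ∘ proj₁ ∘ inside)
      ; blockInP   = All.tabulate (proj₂ ∘ inside)
      ; pairCount  = λ x y x∈S y∈S x≢y →
          trans (count-filter (through? x y) (_⊆? S) Bs
                   (λ B∈Bs (x∈B , y∈B) → subst (_⊆ S) (sym (block-is-line B∈Bs x∈B y∈B x≢y))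
                                                 (S-closed x∈S y∈S x≢y)))
                (pairCount x y ∈⊤ ∈⊤ x≢y)
      ; k>1        = k>1
      ; nontrivial = k<∣S∣
      }
      where
      inside : ∀ {B} → B ∈ filter (_⊆? S) Bs → B ∈ Bs × B ⊆ S
      inside = ∈-filter⁻ (_⊆? S) {xs = Bs}

    lines-from-outside : ∀ {S x y b b′} → Closed S → x ∉ₛ S → b ∈ₛ S → b′ ∈ₛ S → x ≢ y →
                         y ∈ₛ line x b → y ∈ₛ line x b′ → b ≡ b′
    lines-from-outside {S} {x} {y} {b} {b′} S-closed x∉S b∈S b′∈S x≢y y∈xb y∈xb′ with b ≟ b′
    ... | yes b≡b′ = b≡b′
    ... | no  b≢b′ = contradiction (S-closed b∈S b′∈S b≢b′ (subst (x ∈ₛ_) xb≡bb′ (x∈line x≢b))) x∉S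
      where
      apart : ∀ {c} → c ∈ₛ S → x ≢ c
      apart c∈S refl = x∉S c∈S
      x≢b = apart b∈S
      x≢b′ = apart b′∈S
      xb≡xb′ : line x b ≡ line x b′
      xb≡xb′ = trans (block-is-line (line∈Bs x≢b) (x∈line x≢b) y∈xb x≢y)
                     (sym (block-is-line (line∈Bs x≢b′) (x∈line x≢b′) y∈xb′ x≢y))
      xb≡bb′ : line x b ≡ line b b′
      xb≡bb′ = block-is-line (line∈Bs x≢b) (y∈line x≢b) (subst (b′ ∈ₛ_) (sym xb≡xb′) (y∈line x≢b′)) b≢b′

  module Minimal {v k : ℕ} (Bs : List (Subset v)) (design : IsBIBD ⊤ Bs k 1)
                 (𝒟 : List (Subset v)) (𝒟-minimal : IsMinimalCollection Bs k 𝒟) where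

    open Lines Bs design

    minimal : ∀ {D} → D ∈ 𝒟 → IsMinimalSubBIBD Bs k D
    minimal D∈𝒟 = Equivalence.to (proj₂ 𝒟-minimal _) D∈𝒟

    member-closed : ∀ {D} → D ∈ 𝒟 → Closed D
    member-closed = subBIBD-closed ∘ proj₁ ∘ minimal

    k<∣member∣ : ∀ {D} → D ∈ 𝒟 → k < ∣ D ∣
    k<∣member∣ = proj₁ ∘ proj₂ ∘ minimal

    -- A minimal sub-BIBD meeting another member in a line and a point off it is contained in it:
    -- the intersection is closed and has more than k points, so by minimality it is all of D.
    contained : ∀ {D D′ x y z} → D ∈ 𝒟 → D′ ∈ 𝒟 → x ≢ y → z ∉ₛ line x y →
                x ∈ₛ D × y ∈ₛ D × z ∈ₛ D → x ∈ₛ D′ × y ∈ₛ D′ × z ∈ₛ D′ → D ⊆ D′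
    contained {D} {D′} {x} {y} {z} D∈𝒟 D′∈𝒟 x≢y z∉xy (x∈D , y∈D , z∈D) (x∈D′ , y∈D′ , z∈D′) =
      ∣p∣≤∣p∩q∣⇒p⊆q D D′ (proj₂ (proj₂ (minimal D∈𝒟)) (D ∩ D′) (closed-subBIBD ∩closed k<∣∩∣) k<∣∩∣)
      where
      ∩closed : Closed (D ∩ D′)
      ∩closed = ∩-closed (member-closed D∈𝒟) (member-closed D′∈𝒟)
      line⊆∩ : line x y ⊆ D ∩ D′
      line⊆∩ = ∩closed (x∈p∩q⁺ (x∈D , x∈D′)) (x∈p∩q⁺ (y∈D , y∈D′)) x≢y
      k<∣∩∣ : k < ∣ D ∩ D′ ∣
      k<∣∩∣ = subst (_< ∣ D ∩ D′ ∣) (∣line∣ x≢y)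
                    (p⊂q⇒∣p∣<∣q∣ (line⊆∩ , z , x∈p∩q⁺ (z∈D , z∈D′) , z∉xy))

    spanned-by-three : ∀ {D D′ x y z} → D ∈ 𝒟 → D′ ∈ 𝒟 → x ≢ y → z ∉ₛ line x y →
                       x ∈ₛ D × y ∈ₛ D × z ∈ₛ D → x ∈ₛ D′ × y ∈ₛ D′ × z ∈ₛ D′ → D ≡ D′
    spanned-by-three D∈𝒟 D′∈𝒟 x≢y z∉xy in-D in-D′ =
      ⊆-antisym (contained D∈𝒟 D′∈𝒟 x≢y z∉xy in-D in-D′) (contained D′∈𝒟 D∈𝒟 x≢y z∉xy in-D′ in-D)

module Configuration where

  open import Data.Nat as ℕ using (ℕ; suc; _+_; _*_; _∸_; _^_; _≤_; _<_; z≤n; s≤s)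
  open import Data.Nat.Properties hiding (_≟_)
  open import Data.Fin using (Fin; _≟_)
  open import Data.Fin.Subset using (Subset; ⊤; _⊆_; _∩_; _─_; ∣_∣)
    renaming (_∈_ to _∈ₛ_; _∉_ to _∉ₛ_)
  open import Data.Fin.Subset.Properties using (_∈?_; x∈p∩q⁺; x∈p∩q⁻; p─q⊆p; p⊆q⇒∣p∣≤∣q∣; ∩-comm)
  open import Data.List using (List; allFin; cartesianProduct)
  open import Data.List.Membership.Propositional using (_∈_)
  open import Data.List.Relation.Unary.Unique.Propositional.Properties using (allFin⁺)
  open import Data.Product using (_×_; _,_; proj₁; proj₂; ∃)
  open import Function using (_∘_)
  open import Relation.Nullary using (¬_; contradiction)
  open import Relation.Nullary.Decidable using (_×-dec_; ¬?)
  open import Relation.Unary using (Decidable)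
  open import Relation.Binary.PropositionalEquality
  open import Data.Nat.DivMod using (m*n/n≡m; /-monoˡ-≤)
  open import Defs
  open Counting
  open Subsets
  open Geometry

  ≤flr : ∀ {f m k} → 0 < k → f * k ≤ m → f ≤ flr m k
  ≤flr {f} {m} {suc k} _ fk≤m = ≤-trans (≤-reflexive (sym (m*n/n≡m f (suc k)))) (/-monoˡ-≤ (suc k) fk≤m)

  module TwoMembers {v k v′ : ℕ} (Bs : List (Subset v)) (design : IsBIBD ⊤ Bs k 1)
                    (𝒟 : List (Subset v)) (𝒟-minimal : IsMinimalCollection Bs k 𝒟)
                    (sizes : ∀ S → S ∈ 𝒟 → ∣ S ∣ ≡ v′)
                    {D₁ D₂ : Subset v} (D₁∈𝒟 : D₁ ∈ 𝒟) (D₂∈𝒟 : D₂ ∈ 𝒟) {c : ℕ} (∣I∣≡c : ∣ D₁ ∩ D₂ ∣ ≡ c)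
                    where

    open Lines Bs design
    open Minimal Bs design 𝒟 𝒟-minimal

    A C I : Subset v
    A = D₁ ─ D₂
    C = D₂ ─ D₁
    I = D₁ ∩ D₂

    ∣A∣ : ∣ A ∣ ≡ v′ ∸ c
    ∣A∣ = begin
      ∣ A ∣                   ≡⟨ sym (m+n∸m≡n ∣ I ∣ ∣ A ∣) ⟩
      ∣ I ∣ + ∣ A ∣ ∸ ∣ I ∣   ≡⟨ cong₂ _∸_ (sym (∣p∣≡∣p∩q∣+∣p─q∣ D₁ D₂)) ∣I∣≡c ⟩
      ∣ D₁ ∣ ∸ c              ≡⟨ cong (_∸ c) (sizes D₁ D₁∈𝒟) ⟩
      v′ ∸ c                  ∎
      where open ≡-Reasoning

    ∣C∣ : ∣ C ∣ ≡ v′ ∸ c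
    ∣C∣ = begin
      ∣ C ∣                          ≡⟨ sym (m+n∸m≡n ∣ D₂ ∩ D₁ ∣ ∣ C ∣) ⟩
      ∣ D₂ ∩ D₁ ∣ + ∣ C ∣ ∸ ∣ D₂ ∩ D₁ ∣ ≡⟨ cong₂ _∸_ (sym (∣p∣≡∣p∩q∣+∣p─q∣ D₂ D₁)) (trans (cong ∣_∣ (∩-comm D₂ D₁)) ∣I∣≡c) ⟩
      ∣ D₂ ∣ ∸ c                     ≡⟨ cong (_∸ c) (sizes D₂ D₂∈𝒟) ⟩
      v′ ∸ c                         ∎
      where open ≡-Reasoning

    ∈A⁻ : ∀ {x} → x ∈ₛ A → x ∈ₛ D₁ × x ∉ₛ D₂
    ∈A⁻ x∈A = p─q⊆p D₁ D₂ x∈A , x∈p─q⇒x∉q D₁ D₂ x∈A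

    ∈C⁻ : ∀ {x} → x ∈ₛ C → x ∈ₛ D₂ × x ∉ₛ D₁
    ∈C⁻ x∈C = p─q⊆p D₂ D₁ x∈C , x∈p─q⇒x∉q D₂ D₁ x∈C

    size : (S : Subset v) → count (_∈? S) (allFin v) ≡ ∣ S ∣
    size S = sym (∣∣≡count S)

    in-part : ∀ {D x} (S : Subset v) → x ∈ₛ D ∩ S → x ∈ₛ S
    in-part S = proj₂ ∘ x∈p∩q⁻ _ S

    in-member : ∀ {D x} (S : Subset v) → x ∈ₛ D ∩ S → x ∈ₛ D
    in-member {D} S = proj₁ ∘ x∈p∩q⁻ D S

    -- At most one member of 𝒟 passes through two distinct points of D₁ and a point outside D₁:
    -- the third point is off the line of the first two, which lies in D₁.
    one-member-through : ∀ {x y z} {P : Subset v → Set} (P? : Decidable P) →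
                         (∀ {D} → P D → x ≢ y × x ∈ₛ D₁ × y ∈ₛ D₁ × z ∉ₛ D₁) →
                         (∀ {D} → P D → x ∈ₛ D × y ∈ₛ D × z ∈ₛ D) → count P? 𝒟 ≤ 1
    one-member-through P? position through =
      count-≤1 P? 𝒟 (proj₁ 𝒟-minimal) λ D∈𝒟 D′∈𝒟 P-D P-D′ →
        let x≢y , x∈D₁ , y∈D₁ , z∉D₁ = position P-D
        in  spanned-by-three D∈𝒟 D′∈𝒟 x≢y (z∉D₁ ∘ member-closed D₁∈𝒟 x∈D₁ y∈D₁ x≢y)
                             (through P-D) (through P-D′)

    Other : Fin v → Fin v → Set
    Other x y = y ∈ₛ D₁ × x ≢ y

    other? : ∀ x → Decidable (Other x)
    other? x y = (y ∈? D₁) ×-dec ¬? (x ≟ y)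

    good? : ∀ x → Decidable (λ y → Other x y × ∣ line x y ∩ I ∣ ≡ 0)
    bad?  : ∀ x → Decidable (λ y → Other x y × ¬ ∣ line x y ∩ I ∣ ≡ 0)
    good? x y = other? x y ×-dec (∣ line x y ∩ I ∣ ℕ.≟ 0)
    bad?  x y = other? x y ×-dec ¬? (∣ line x y ∩ I ∣ ℕ.≟ 0)

    module _ {x : Fin v} (x∈A : x ∈ₛ A) where

      private
        x∈D₁ = proj₁ (∈A⁻ x∈A)
        x∉D₂ = proj₂ (∈A⁻ x∈A)
        x≢ : ∀ {b} → b ∈ₛ I → x ≢ b
        x≢ b∈I refl = x∉D₂ (proj₂ (x∈p∩q⁻ D₁ D₂ b∈I))

      -- The lines from x to the c points of I are distinct; each carries k ∸ 1 points other than x,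
      -- all of them bad. Hence there are at least c * (k ∸ 1) bad points.
      bad-points : c * (k ∸ 1) ≤ count (bad? x) (allFin v)
      bad-points = subst₂ _≤_
        (cong (_* (k ∸ 1)) (trans (size I) ∣I∣≡c))
        (*-identityʳ _)
        (double-count (_∈? I) (λ b y → (y ∈? line x b) ×-dec ¬? (x ≟ y)) (bad? x)
                      (allFin v) (allFin v) on-line bad (λ y → count-≤1 _ (allFin v) (allFin⁺ v) (same-line y)))
        where
        on-line : ∀ {b} → b ∈ allFin v → b ∈ₛ I → count (λ y → (y ∈? line x b) ×-dec ¬? (x ≟ y)) (allFin v) ≡ k ∸ 1
        on-line _ b∈I = trans (count-others (x∈line (x≢ b∈I))) (cong (_∸ 1) (∣line∣ (x≢ b∈I)))
        bad : ∀ {b y} → b ∈ allFin v → b ∈ₛ I → y ∈ₛ line x b × x ≢ y →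
              (y ∈ₛ D₁ × x ≢ y) × ¬ ∣ line x y ∩ I ∣ ≡ 0
        bad {b} {y} _ b∈I (y∈xb , x≢y) =
          ( member-closed D₁∈𝒟 x∈D₁ (proj₁ (x∈p∩q⁻ D₁ D₂ b∈I)) (x≢ b∈I) y∈xb , x≢y)
          , λ empty → contradiction empty (m<n⇒n≢0 (member⇒∣∣>0 (x∈p∩q⁺ (b∈xy , b∈I))))
          where
          b∈xy : b ∈ₛ line x y
          b∈xy = subst (b ∈ₛ_) (block-is-line (line∈Bs (x≢ b∈I)) (x∈line (x≢ b∈I)) y∈xb x≢y) (y∈line (x≢ b∈I))
        same-line : ∀ y {b b′} → b ∈ allFin v → b′ ∈ allFin v →
                    b ∈ₛ I × y ∈ₛ line x b × x ≢ y → b′ ∈ₛ I × y ∈ₛ line x b′ × x ≢ y → b ≡ b′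
        same-line y _ _ (b∈I , y∈xb , x≢y) (b′∈I , y∈xb′ , _) =
          lines-from-outside (member-closed D₂∈𝒟) x∉D₂
            (proj₂ (x∈p∩q⁻ D₁ D₂ b∈I)) (proj₂ (x∈p∩q⁻ D₁ D₂ b′∈I)) x≢y y∈xb y∈xb′

      -- The other v′ ∸ 1 points of D₁ are good or bad, and at least c * (k ∸ 1) of them are bad.
      good-points : count (good? x) (allFin v) + (c * (k ∸ 1) + 1) ≤ v′
      good-points = begin
        count (good? x) (allFin v) + (c * (k ∸ 1) + 1)
          ≤⟨ +-monoʳ-≤ (count (good? x) (allFin v)) (+-monoˡ-≤ 1 bad-points) ⟩
        count (good? x) (allFin v) + (count (bad? x) (allFin v) + 1)
          ≡⟨ sym (+-assoc (count (good? x) (allFin v)) _ 1) ⟩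
        count (good? x) (allFin v) + count (bad? x) (allFin v) + 1
          ≡⟨ cong (_+ 1) (sym (count-split (other? x) (λ y → ∣ line x y ∩ I ∣ ℕ.≟ 0) (allFin v))) ⟩
        count (other? x) (allFin v) + 1
          ≡⟨ cong (_+ 1) (count-others x∈D₁) ⟩
        ∣ D₁ ∣ ∸ 1 + 1
          ≡⟨ m∸n+n≡m (member⇒∣∣>0 x∈D₁) ⟩
        ∣ D₁ ∣
          ≡⟨ sizes D₁ D₁∈𝒟 ⟩
        v′ ∎
        where open ≤-Reasoning

    g : ℕ
    g = v′ ∸ (c * (k ∸ 1) + 1)

    good≤g : ∀ {x} → x ∈ₛ A → count (good? x) (allFin v) ≤ g
    good≤g x∈A = m+n≤o⇒m≤o∸n _ (good-points x∈A)

    good-in-member : ∀ {D x y} → D ∈ 𝒟 → ∣ D ∩ I ∣ ≡ 0 → x ∈ₛ D → y ∈ₛ D → x ≢ y → y ∈ₛ D₁ →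
                     Other x y × ∣ line x y ∩ I ∣ ≡ 0
    good-in-member {D} {x} {y} D∈𝒟 D∩I≡0 x∈D y∈D x≢y y∈D₁ =
      (y∈D₁ , x≢y) , n≤0⇒n≡0 (≤-trans (p⊆q⇒∣p∣≤∣q∣ line∩I⊆D∩I) (≤-reflexive D∩I≡0))
      where
      line∩I⊆D∩I : line x y ∩ I ⊆ D ∩ I
      line∩I⊆D∩I z∈ = x∈p∩q⁺ ( member-closed D∈𝒟 x∈D y∈D x≢y (proj₁ (x∈p∩q⁻ (line x y) I z∈))
                              , proj₂ (x∈p∩q⁻ (line x y) I z∈))

    Profile : ℕ → ℕ → ℕ → Subset v → Set
    Profile x₁ x₂ x₃ D = D ≢ D₁ × D ≢ D₂ × ∣ D ∩ A ∣ ≡ x₁ × ∣ D ∩ I ∣ ≡ x₂ × ∣ D ∩ C ∣ ≡ x₃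

    profile? : ∀ x₁ x₂ x₃ → Decidable (Profile x₁ x₂ x₃)
    profile? x₁ x₂ x₃ D = ¬? (D ≟S D₁) ×-dec ¬? (D ≟S D₂) ×-dec
                          (∣ D ∩ A ∣ ℕ.≟ x₁) ×-dec (∣ D ∩ I ∣ ℕ.≟ x₂) ×-dec (∣ D ∩ C ∣ ℕ.≟ x₃)

    pairs : List (Fin v × Fin v)
    pairs = cartesianProduct (allFin v) (allFin v)

    triples : List ((Fin v × Fin v) × Fin v)
    triples = cartesianProduct pairs (allFin v)

    DistinctIn : Subset v → Fin v × Fin v → Set
    DistinctIn S (x , y) = x ∈ₛ S × y ∈ₛ S × x ≢ y

    distinct-in? : (S : Subset v) → Decidable (DistinctIn S)
    distinct-in? S t = (proj₁ t ∈? S) ×-dec ((proj₂ t ∈? S) ×-dec ¬? (proj₁ t ≟ proj₂ t))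

    GoodPair : Fin v × Fin v → Set
    GoodPair (x , y) = x ∈ₛ A × Other x y × ∣ line x y ∩ I ∣ ≡ 0

    good-pair? : Decidable GoodPair
    good-pair? t = (proj₁ t ∈? A) ×-dec good? (proj₁ t) (proj₂ t)

    good-pairs : count good-pair? pairs ≤ (v′ ∸ c) * g
    good-pairs = subst (count good-pair? pairs ≤_) (cong (_* g) (trans (size A) ∣A∣))
                       (count-⊗-≤ (_∈? A) good? (allFin v) (allFin v) good≤g)

    -- Members of profile (k , 0 , k) through a pair of points of A meet C in pairwise disjoint
    -- k-sets (a common point of C would determine them), so there are at most ⌊ ∣ C ∣ / k ⌋.
    members-through-pair : ∀ x y →
      count (λ D → profile? k 0 k D ×-dec distinct-in? (D ∩ A) (x , y)) 𝒟 ≤ flr (v′ ∸ c) k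
    members-through-pair x y = ≤flr (<-trans (s≤s z≤n) (IsBIBD.k>1 design)) (begin
      count P? 𝒟 * k                  ≤⟨ double-count P? (λ D z → z ∈? D ∩ C) (_∈? C) 𝒟 (allFin v)
                                                      meets-C-in-k (λ _ _ → in-part C) one-member ⟩
      count (_∈? C) (allFin v) * 1    ≡⟨ trans (*-identityʳ _) (trans (size C) ∣C∣) ⟩
      v′ ∸ c                          ∎)
      where
      open ≤-Reasoning
      P? : Decidable (λ D → Profile k 0 k D × DistinctIn (D ∩ A) (x , y))
      P? D = profile? k 0 k D ×-dec distinct-in? (D ∩ A) (x , y)
      meets-C-in-k : ∀ {D} → D ∈ 𝒟 → Profile k 0 k D × DistinctIn (D ∩ A) (x , y) →
                     count (λ z → z ∈? D ∩ C) (allFin v) ≡ k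
      meets-C-in-k {D} _ ((_ , _ , _ , _ , ∣D∩C∣) , _) = trans (size (D ∩ C)) ∣D∩C∣
      one-member : ∀ z → count (λ D → P? D ×-dec (z ∈? D ∩ C)) 𝒟 ≤ 1
      one-member z = one-member-through _
        (λ { ((_ , (x∈ , y∈ , x≢y)) , z∈) →
             x≢y , proj₁ (∈A⁻ (in-part A x∈)) , proj₁ (∈A⁻ (in-part A y∈)) , proj₂ (∈C⁻ (in-part C z∈)) })
        (λ { ((_ , (x∈ , y∈ , _)) , z∈) → in-member A x∈ , in-member A y∈ , in-member C z∈ })

    -- A member of profile (k , 0 , k) has k (k ∸ 1) ordered pairs in A, all good pairs; each good
    -- pair lies in at most ⌊ (v′ ∸ c) / k ⌋ such members.
    count-k0k : N 𝒟 D₁ D₂ k 0 k * (k * (k ∸ 1)) ≤ (v′ ∸ c) * g * flr (v′ ∸ c) k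
    count-k0k = ≤-trans
      (double-count (profile? k 0 k) (λ D → distinct-in? (D ∩ A)) good-pair? 𝒟 pairs
                    pairs-in-A good (λ (x , y) → members-through-pair x y))
      (*-monoˡ-≤ _ good-pairs)
      where
      pairs-in-A : ∀ {D} → D ∈ 𝒟 → Profile k 0 k D → count (distinct-in? (D ∩ A)) pairs ≡ k * (k ∸ 1)
      pairs-in-A {D} _ (_ , _ , ∣D∩A∣ , _) = trans (ordered-pairs (D ∩ A)) (cong (λ m → m * (m ∸ 1)) ∣D∩A∣)
      good : ∀ {D x y} → D ∈ 𝒟 → Profile k 0 k D → DistinctIn (D ∩ A) (x , y) → GoodPair (x , y)
      good D∈𝒟 (_ , _ , _ , ∣D∩I∣ , _) (x∈ , y∈ , x≢y) =
        in-part A x∈ , good-in-member D∈𝒟 ∣D∩I∣ (in-member A x∈) (in-member A y∈) x≢y (proj₁ (∈A⁻ (in-part A y∈)))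

    -- A member of profile (k , 0 , 1) has k (k ∸ 1) triples (x , y , z) with (x , y) a pair in A and
    -- z its point in C; (x , y) is then good, and the triple determines the member.
    count-k01 : N 𝒟 D₁ D₂ k 0 1 * (k * (k ∸ 1)) ≤ (v′ ∸ c) * g * (v′ ∸ c)
    count-k01 = begin
      N 𝒟 D₁ D₂ k 0 1 * (k * (k ∸ 1))
        ≤⟨ double-count (profile? k 0 1) W? R? 𝒟 triples triples-in good one-member ⟩
      count R? triples * 1
        ≡⟨ trans (*-identityʳ _) (count-× good-pair? (_∈? C) pairs (allFin v)) ⟩
      count good-pair? pairs * count (_∈? C) (allFin v)
        ≤⟨ *-mono-≤ good-pairs (≤-reflexive (trans (size C) ∣C∣)) ⟩
      (v′ ∸ c) * g * (v′ ∸ c) ∎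
      where
      open ≤-Reasoning
      W? : ∀ D → Decidable (λ t → DistinctIn (D ∩ A) (proj₁ t) × proj₂ t ∈ₛ D ∩ C)
      W? D t = distinct-in? (D ∩ A) (proj₁ t) ×-dec (proj₂ t ∈? D ∩ C)
      R? : Decidable (λ t → GoodPair (proj₁ t) × proj₂ t ∈ₛ C)
      R? t = good-pair? (proj₁ t) ×-dec (proj₂ t ∈? C)
      triples-in : ∀ {D} → D ∈ 𝒟 → Profile k 0 1 D → count (W? D) triples ≡ k * (k ∸ 1)
      triples-in {D} _ (_ , _ , ∣D∩A∣ , _ , ∣D∩C∣) = begin-equality
        count (W? D) triples
          ≡⟨ count-× (distinct-in? (D ∩ A)) (_∈? D ∩ C) pairs (allFin v) ⟩
        count (distinct-in? (D ∩ A)) pairs * count (_∈? D ∩ C) (allFin v)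
          ≡⟨ cong₂ _*_ (trans (ordered-pairs (D ∩ A)) (cong (λ m → m * (m ∸ 1)) ∣D∩A∣)) (trans (size (D ∩ C)) ∣D∩C∣) ⟩
        k * (k ∸ 1) * 1
          ≡⟨ *-identityʳ _ ⟩
        k * (k ∸ 1) ∎
      good : ∀ {D t} → D ∈ 𝒟 → Profile k 0 1 D → DistinctIn (D ∩ A) (proj₁ t) × proj₂ t ∈ₛ D ∩ C →
             GoodPair (proj₁ t) × proj₂ t ∈ₛ C
      good D∈𝒟 (_ , _ , _ , ∣D∩I∣ , _) ((x∈ , y∈ , x≢y) , z∈) =
        ( in-part A x∈
        , good-in-member D∈𝒟 ∣D∩I∣ (in-member A x∈) (in-member A y∈) x≢y (proj₁ (∈A⁻ (in-part A y∈))))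
        , in-part C z∈
      one-member : ∀ t → count (λ D → profile? k 0 1 D ×-dec W? D t) 𝒟 ≤ 1
      one-member t = one-member-through _
        (λ { (_ , (x∈ , y∈ , x≢y) , z∈) →
             x≢y , proj₁ (∈A⁻ (in-part A x∈)) , proj₁ (∈A⁻ (in-part A y∈)) , proj₂ (∈C⁻ (in-part C z∈)) })
        (λ { (_ , (x∈ , y∈ , _) , z∈) → in-member A x∈ , in-member A y∈ , in-member C z∈ })

    -- A member of profile (k ∸ 1 , 1 , k ∸ 1) has (k ∸ 1)² triples (q , x , y) in I × A × C, and
    -- such a triple determines the member.
    count-mid : N 𝒟 D₁ D₂ (k ∸ 1) 1 (k ∸ 1) * (k ∸ 1) ^ 2 ≤ c * (v′ ∸ c) * (v′ ∸ c)
    count-mid = begin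
      N 𝒟 D₁ D₂ (k ∸ 1) 1 (k ∸ 1) * (k ∸ 1) ^ 2
        ≤⟨ double-count (profile? (k ∸ 1) 1 (k ∸ 1)) W? R? 𝒟 triples triples-in regions one-member ⟩
      count R? triples * 1
        ≡⟨ trans (*-identityʳ _) (trans (count-× (in-both I A) (_∈? C) pairs (allFin v))
                                        (cong (_* count (_∈? C) (allFin v)) (count-× (_∈? I) (_∈? A) (allFin v) (allFin v)))) ⟩
      count (_∈? I) (allFin v) * count (_∈? A) (allFin v) * count (_∈? C) (allFin v)
        ≡⟨ cong₂ _*_ (cong₂ _*_ (trans (size I) ∣I∣≡c) (trans (size A) ∣A∣)) (trans (size C) ∣C∣) ⟩
      c * (v′ ∸ c) * (v′ ∸ c) ∎
      where
      open ≤-Reasoning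
      in-both : (S T : Subset v) → Decidable (λ t → proj₁ t ∈ₛ S × proj₂ t ∈ₛ T)
      in-both S T t = (proj₁ t ∈? S) ×-dec (proj₂ t ∈? T)
      W? : ∀ D → Decidable (λ t → (proj₁ (proj₁ t) ∈ₛ D ∩ I × proj₂ (proj₁ t) ∈ₛ D ∩ A) × proj₂ t ∈ₛ D ∩ C)
      W? D t = in-both (D ∩ I) (D ∩ A) (proj₁ t) ×-dec (proj₂ t ∈? D ∩ C)
      R? : Decidable (λ t → (proj₁ (proj₁ t) ∈ₛ I × proj₂ (proj₁ t) ∈ₛ A) × proj₂ t ∈ₛ C)
      R? t = in-both I A (proj₁ t) ×-dec (proj₂ t ∈? C)
      triples-in : ∀ {D} → D ∈ 𝒟 → Profile (k ∸ 1) 1 (k ∸ 1) D → count (W? D) triples ≡ (k ∸ 1) ^ 2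
      triples-in {D} _ (_ , _ , ∣D∩A∣ , ∣D∩I∣ , ∣D∩C∣) = begin-equality
        count (W? D) triples
          ≡⟨ count-× (in-both (D ∩ I) (D ∩ A)) (_∈? D ∩ C) pairs (allFin v) ⟩
        count (in-both (D ∩ I) (D ∩ A)) pairs * count (_∈? D ∩ C) (allFin v)
          ≡⟨ cong (_* count (_∈? D ∩ C) (allFin v)) (count-× (_∈? D ∩ I) (_∈? D ∩ A) (allFin v) (allFin v)) ⟩
        count (_∈? D ∩ I) (allFin v) * count (_∈? D ∩ A) (allFin v) * count (_∈? D ∩ C) (allFin v)
          ≡⟨ cong₂ _*_ (cong₂ _*_ (trans (size (D ∩ I)) ∣D∩I∣) (trans (size (D ∩ A)) ∣D∩A∣)) (trans (size (D ∩ C)) ∣D∩C∣) ⟩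
        1 * (k ∸ 1) * (k ∸ 1)
          ≡⟨ cong₂ _*_ (*-identityˡ (k ∸ 1)) (sym (*-identityʳ (k ∸ 1))) ⟩
        (k ∸ 1) ^ 2 ∎
      regions : ∀ {D t} → D ∈ 𝒟 → Profile (k ∸ 1) 1 (k ∸ 1) D → (proj₁ (proj₁ t) ∈ₛ D ∩ I × proj₂ (proj₁ t) ∈ₛ D ∩ A) × proj₂ t ∈ₛ D ∩ C →
                (proj₁ (proj₁ t) ∈ₛ I × proj₂ (proj₁ t) ∈ₛ A) × proj₂ t ∈ₛ C
      regions _ _ ((q∈ , x∈) , y∈) = (in-part I q∈ , in-part A x∈) , in-part C y∈
      one-member : ∀ t → count (λ D → profile? (k ∸ 1) 1 (k ∸ 1) D ×-dec W? D t) 𝒟 ≤ 1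
      one-member t = one-member-through _
        (λ { (_ , (q∈ , x∈) , y∈) →
             (λ { refl → proj₂ (∈A⁻ (in-part A x∈)) (proj₂ (x∈p∩q⁻ D₁ D₂ (in-part I q∈))) })
             , proj₁ (x∈p∩q⁻ D₁ D₂ (in-part I q∈)) , proj₁ (∈A⁻ (in-part A x∈)) , proj₂ (∈C⁻ (in-part C y∈)) })
        (λ { (_ , (q∈ , x∈) , y∈) → in-member I q∈ , in-member A x∈ , in-member C y∈ })

    k<v′ : k < v′
    k<v′ = subst (k <_) (sizes D₁ D₁∈𝒟) (k<∣member∣ D₁∈𝒟)

    -- When c ≤ k the region A is nonempty (as k < v′), so g really is v′ minus c * (k ∸ 1) + 1.
    g+ : c ≤ k → g + (c * (k ∸ 1) + 1) ≡ v′
    g+ c≤k = m∸n+n≡m (m+n≤o⇒n≤o (count (good? (proj₁ point-of-A)) (allFin v)) (good-points (proj₂ point-of-A)))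
      where
      point-of-A : ∃ λ x → x ∈ₛ A
      point-of-A = nonempty A (subst (0 <_) (sym ∣A∣) (m<n⇒0<n∸m (≤-<-trans c≤k k<v′)))

module IntegerBounds where

  open import Defs
  open import Data.Nat using (ℕ; _∸_; _*_; _^_)
  open import Data.Integer using (+_; _-_) renaming (_*_ to _*ℤ_; _+_ to _+ℤ_)
  open import Data.Fin.Subset using (Subset; ⊤; ∣_∣)
  open import Data.List using (List)
  open import Data.List.Membership.Propositional using (_∈_; find)
  open import Data.Product using (_×_)
  open import Relation.Binary.PropositionalEquality using (_≡_)

  import Data.Nat as ℕ
  import Data.Nat.Properties as ℕ
  open import Data.Integer as ℤ using (ℤ)
  import Data.Integer.Properties as ℤ
  open import Data.Integer.Tactic.RingSolver using (solve-∀)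
  open import Data.Fin.Subset using (_∩_)
  open import Data.List using ([]; _∷_; map; length)
  open import Data.Nat.ListAction using (sum)
  open import Data.List.Membership.Propositional.Properties using (∈-filter⁻; ∈-concatMap⁻; ∈-map⁻)
  open import Data.List.Relation.Unary.Any using (here; there)
  open import Data.Product using (_,_; proj₁; proj₂)
  open import Relation.Nullary.Decidable using (_×-dec_; ¬?)
  open import Relation.Binary.PropositionalEquality using (refl; sym; trans; cong; subst; _≢_)
  open import Function using (_∘_)
  open Configuration

  bounded-by : ∀ n {den X num} → n ℕ.* den ℕ.≤ X → + X ≡ num → BoundedBy n num den
  bounded-by n {den} {X} n*den≤X refl = subst (ℤ._≤ + X) (ℤ.pos-* n den) (ℤ.+≤+ n*den≤X)

  sum-bounded : ∀ {P : Set} {num den} (ps : List P) (f : P → ℕ) →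
                (∀ {p} → p ∈ ps → BoundedBy (f p) num den) →
                + sum (map f ps) *ℤ + den ℤ.≤ + length ps *ℤ num
  sum-bounded []       f bounded = ℤ.+≤+ ℕ.z≤n
  sum-bounded {num = num} {den} (p ∷ ps) f bounded = begin
    + (f p ℕ.+ sum (map f ps)) *ℤ + den        ≡⟨ cong (_*ℤ + den) (ℤ.pos-+ (f p) (sum (map f ps))) ⟩
    (+ f p +ℤ + sum (map f ps)) *ℤ + den       ≡⟨ ℤ.*-distribʳ-+ (+ den) (+ f p) (+ sum (map f ps)) ⟩
    + f p *ℤ + den +ℤ + sum (map f ps) *ℤ + den ≤⟨ ℤ.+-mono-≤ (bounded (here refl)) (sum-bounded ps f (bounded ∘ there)) ⟩
    num +ℤ + length ps *ℤ num                  ≡⟨ cong (_+ℤ + length ps *ℤ num) (sym (ℤ.*-identityˡ num)) ⟩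
    + 1 *ℤ num +ℤ + length ps *ℤ num           ≡⟨ sym (ℤ.*-distribʳ-+ num (+ 1) (+ length ps)) ⟩
    + length (p ∷ ps) *ℤ num                   ∎
    where open ℤ.≤-Reasoning

  Pointwise : ∀ {v} → List (Subset v) → ℕ → ℕ → ℕ → ℕ → ℤ → ℕ → Set
  Pointwise 𝒟 c x₁ x₂ x₃ num den =
    ∀ D₁ D₂ → D₁ ∈ 𝒟 → D₂ ∈ 𝒟 → D₁ ≢ D₂ → ∣ D₁ ∩ D₂ ∣ ≡ c → BoundedBy (N 𝒟 D₁ D₂ x₁ x₂ x₃) num den

  bound-for : ∀ {v} {𝒟 : List (Subset v)} {c x₁ x₂ x₃ num num′ den} →
              num ≡ num′ → Pointwise 𝒟 c x₁ x₂ x₃ num den → BoundFor 𝒟 c x₁ x₂ x₃ num′ den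
  bound-for {𝒟 = 𝒟} {c} {x₁} {x₂} {x₃} {num} {den = den} refl pointwise =
    pointwise , sum-bounded (pairsWith 𝒟 c) (λ (D₁ , D₂) → N 𝒟 D₁ D₂ x₁ x₂ x₃) listed
    where
    listed : ∀ {p} → p ∈ pairsWith 𝒟 c → BoundedBy (N 𝒟 (proj₁ p) (proj₂ p) x₁ x₂ x₃) num den
    listed p∈ with ∈-filter⁻ (λ p → ¬? (proj₁ p ≟S proj₂ p) ×-dec (∣ proj₁ p ∩ proj₂ p ∣ ℕ.≟ c)) p∈
    ... | p∈pairs , D₁≢D₂ , ∣D₁∩D₂∣ with find (∈-concatMap⁻ (λ D₁ → map (D₁ ,_) 𝒟) {xs = 𝒟} p∈pairs)
    ...   | D₁ , D₁∈𝒟 , p∈row with ∈-map⁻ (D₁ ,_) p∈row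
    ...     | D₂ , D₂∈𝒟 , refl = pointwise D₁ D₂ D₁∈𝒟 D₂∈𝒟 D₁≢D₂ ∣D₁∩D₂∣

  +∸ : ∀ {m n} → m ℕ.≤ n → + (n ∸ m) ≡ + n - + m
  +∸ {m} {n} m≤n = sym (trans (ℤ.m-n≡m⊖n n m) (ℤ.⊖-≥ m≤n))

  +*3 : ∀ {a b c α β γ} → + a ≡ α → + b ≡ β → + c ≡ γ → + (a * b * c) ≡ α *ℤ β *ℤ γ
  +*3 {a} {b} {c} refl refl refl = trans (ℤ.pos-* (a * b) c) (cong (_*ℤ + c) (ℤ.pos-* a b))

  module Bounds {v k v′ : ℕ} (Bs : List (Subset v)) (design : IsBIBD ⊤ Bs k 1)
                (𝒟 : List (Subset v)) (𝒟-minimal : IsMinimalCollection Bs k 𝒟)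
                (sizes : ∀ S → S ∈ 𝒟 → ∣ S ∣ ≡ v′) where

    1≤k : 1 ℕ.≤ k
    1≤k = ℕ.<⇒≤ (IsBIBD.k>1 design)

    G : ℕ → ℤ
    G c = + v′ - (+ c *ℤ (+ k - + 1) +ℤ + 1)

    module Casts {D₁ D₂ : Subset v} (D₁∈𝒟 : D₁ ∈ 𝒟) (D₂∈𝒟 : D₂ ∈ 𝒟) {c : ℕ} (∣D₁∩D₂∣ : ∣ D₁ ∩ D₂ ∣ ≡ c)
                 (c≤k : c ℕ.≤ k) where

      open TwoMembers Bs design 𝒟 𝒟-minimal sizes D₁∈𝒟 D₂∈𝒟 ∣D₁∩D₂∣ public

      +a : + (v′ ∸ c) ≡ + v′ - + c
      +a = +∸ (ℕ.≤-trans c≤k (ℕ.<⇒≤ k<v′))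

      +g : + g ≡ G c
      +g = trans (+∸ (subst (c * (k ∸ 1) ℕ.+ 1 ℕ.≤_) (g+ c≤k) (ℕ.m≤n+m _ g)))
                 (cong (+ v′ -_) (trans (ℤ.pos-+ (c * (k ∸ 1)) 1)
                                        (cong (_+ℤ + 1) (trans (ℤ.pos-* c (k ∸ 1)) (cong (+ c *ℤ_) (+∸ 1≤k))))))

    bound-k0k : ∀ c → c ℕ.≤ k → Pointwise 𝒟 c k 0 k ((+ v′ - + c) *ℤ G c *ℤ + flr (v′ ∸ c) k) (k * (k ∸ 1))
    bound-k0k c c≤k D₁ D₂ D₁∈𝒟 D₂∈𝒟 _ ∣D₁∩D₂∣ = bounded-by (N 𝒟 D₁ D₂ k 0 k) count-k0k (+*3 +a +g refl)
      where open Casts D₁∈𝒟 D₂∈𝒟 ∣D₁∩D₂∣ c≤k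

    bound-mid : ∀ c → c ℕ.≤ k → Pointwise 𝒟 c (k ∸ 1) 1 (k ∸ 1) (+ c *ℤ (+ v′ - + c) *ℤ (+ v′ - + c)) ((k ∸ 1) ^ 2)
    bound-mid c c≤k D₁ D₂ D₁∈𝒟 D₂∈𝒟 _ ∣D₁∩D₂∣ = bounded-by (N 𝒟 D₁ D₂ (k ∸ 1) 1 (k ∸ 1)) count-mid (+*3 {c} refl +a +a)
      where open Casts D₁∈𝒟 D₂∈𝒟 ∣D₁∩D₂∣ c≤k

    bound-k01 : ∀ c → c ℕ.≤ k → Pointwise 𝒟 c k 0 1 ((+ v′ - + c) *ℤ G c *ℤ (+ v′ - + c)) (k * (k ∸ 1))
    bound-k01 c c≤k D₁ D₂ D₁∈𝒟 D₂∈𝒟 _ ∣D₁∩D₂∣ = bounded-by (N 𝒟 D₁ D₂ k 0 1) count-k01 (+*3 +a +g +a)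
      where open Casts D₁∈𝒟 D₂∈𝒟 ∣D₁∩D₂∣ c≤k

    -- Members meeting in one point (c = 1), so that g = v′ - k.
    meeting-in-a-point :
      BoundFor 𝒟 1 k 0 k ((+ v′ - + 1) *ℤ (+ v′ - + k) *ℤ + flr (v′ ∸ 1) k) (k * (k ∸ 1))
      × BoundFor 𝒟 1 (k ∸ 1) 1 (k ∸ 1) ((+ v′ - + 1) *ℤ (+ v′ - + 1)) ((k ∸ 1) ^ 2)
      × BoundFor 𝒟 1 k 0 1 ((+ v′ - + 1) *ℤ (+ v′ - + 1) *ℤ (+ v′ - + k)) (k * (k ∸ 1))
    meeting-in-a-point =
        bound-for (k0k (+ v′) (+ k) (+ flr (v′ ∸ 1) k)) (bound-k0k 1 1≤k)
      , bound-for (mid (+ v′))                           (bound-mid 1 1≤k)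
      , bound-for (k01 (+ v′) (+ k))                     (bound-k01 1 1≤k)
      where
      k0k : ∀ V K F → (V - + 1) *ℤ (V - (+ 1 *ℤ (K - + 1) +ℤ + 1)) *ℤ F ≡ (V - + 1) *ℤ (V - K) *ℤ F
      k0k = solve-∀
      mid : ∀ V → + 1 *ℤ (V - + 1) *ℤ (V - + 1) ≡ (V - + 1) *ℤ (V - + 1)
      mid = solve-∀
      k01 : ∀ V K → (V - + 1) *ℤ (V - (+ 1 *ℤ (K - + 1) +ℤ + 1)) *ℤ (V - + 1) ≡ (V - + 1) *ℤ (V - + 1) *ℤ (V - K)
      k01 = solve-∀

    -- Members meeting in a line (c = k), so that g = v′ - k² + k - 1.
    meeting-in-a-line :
      BoundFor 𝒟 k k 0 k ((+ v′ - + k *ℤ + k +ℤ + k - + 1) *ℤ (+ v′ - + k) *ℤ + flr (v′ ∸ k) k) (k * (k ∸ 1))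
      × BoundFor 𝒟 k (k ∸ 1) 1 (k ∸ 1) (+ k *ℤ (+ v′ - + k) *ℤ (+ v′ - + k)) ((k ∸ 1) ^ 2)
      × BoundFor 𝒟 k k 0 1 ((+ v′ - + k *ℤ + k +ℤ + k - + 1) *ℤ (+ v′ - + k) *ℤ (+ v′ - + k)) (k * (k ∸ 1))
    meeting-in-a-line =
        bound-for (k0k (+ v′) (+ k) (+ flr (v′ ∸ k) k)) (bound-k0k k ℕ.≤-refl)
      , bound-for refl                                   (bound-mid k ℕ.≤-refl)
      , bound-for (k01 (+ v′) (+ k))                     (bound-k01 k ℕ.≤-refl)
      where
      k0k : ∀ V K F → (V - K) *ℤ (V - (K *ℤ (K - + 1) +ℤ + 1)) *ℤ F ≡ (V - K *ℤ K +ℤ K - + 1) *ℤ (V - K) *ℤ F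
      k0k = solve-∀
      k01 : ∀ V K → (V - K) *ℤ (V - (K *ℤ (K - + 1) +ℤ + 1)) *ℤ (V - K) ≡ (V - K *ℤ K +ℤ K - + 1) *ℤ (V - K) *ℤ (V - K)
      k01 = solve-∀

    -- Disjoint members (c = 0), so that g = v′ - 1.
    disjoint :
      BoundFor 𝒟 0 k 0 k (+ v′ *ℤ (+ v′ - + 1) *ℤ + flr v′ k) (k * (k ∸ 1))
      × BoundFor 𝒟 0 k 0 1 (+ v′ *ℤ + v′ *ℤ (+ v′ - + 1)) (k * (k ∸ 1))
    disjoint =
        bound-for (k0k (+ v′) (+ k) (+ flr v′ k)) (bound-k0k 0 ℕ.z≤n)
      , bound-for (k01 (+ v′) (+ k))              (bound-k01 0 ℕ.z≤n)
      where
      k0k : ∀ V K F → (V - + 0) *ℤ (V - (+ 0 *ℤ (K - + 1) +ℤ + 1)) *ℤ F ≡ V *ℤ (V - + 1) *ℤ F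
      k0k = solve-∀
      k01 : ∀ V K → (V - + 0) *ℤ (V - (+ 0 *ℤ (K - + 1) +ℤ + 1)) *ℤ (V - + 0) ≡ V *ℤ V *ℤ (V - + 1)
      k01 = solve-∀

open import Defs
open import Data.Nat using (ℕ; _∸_; _*_; _^_)
open import Data.Integer using (+_; _-_) renaming (_*_ to _*ℤ_; _+_ to _+ℤ_)
open import Data.Fin.Subset using (Subset; ⊤; ∣_∣)
open import Data.List using (List)
open import Data.List.Membership.Propositional using (_∈_)
open import Data.Product using (_×_)
open import Relation.Binary.PropositionalEquality using (_≡_)
open import Data.Product using (_,_)
open IntegerBounds using (module Bounds)

proposition2p14 : {v k v′ : ℕ} (Bs : List (Subset v)) → IsBIBD ⊤ Bs k 1 →
    (𝒟 : List (Subset v)) → IsMinimalCollection Bs k 𝒟 →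
    (∀ S → S ∈ 𝒟 → ∣ S ∣ ≡ v′) → WellDistributed Bs 𝒟 →
    -- |D1 ∩ D2| = 1
    (BoundFor 𝒟 1 k 0 k ((+ v′ - + 1) *ℤ (+ v′ - + k) *ℤ + flr (v′ ∸ 1) k) (k * (k ∸ 1))
    × BoundFor 𝒟 1 (k ∸ 1) 1 (k ∸ 1) ((+ v′ - + 1) *ℤ (+ v′ - + 1)) ((k ∸ 1) ^ 2)
    × BoundFor 𝒟 1 k 0 1 ((+ v′ - + 1) *ℤ (+ v′ - + 1) *ℤ (+ v′ - + k)) (k * (k ∸ 1)))
    × -- |D1 ∩ D2| = k
    (BoundFor 𝒟 k k 0 k ((+ v′ - + k *ℤ + k +ℤ + k - + 1) *ℤ (+ v′ - + k) *ℤ + flr (v′ ∸ k) k)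
        (k * (k ∸ 1))
    × BoundFor 𝒟 k (k ∸ 1) 1 (k ∸ 1) (+ k *ℤ (+ v′ - + k) *ℤ (+ v′ - + k)) ((k ∸ 1) ^ 2)
    × BoundFor 𝒟 k k 0 1 ((+ v′ - + k *ℤ + k +ℤ + k - + 1) *ℤ (+ v′ - + k) *ℤ (+ v′ - + k))
        (k * (k ∸ 1)))
    × -- D1 ∩ D2 = ∅
    (BoundFor 𝒟 0 k 0 k (+ v′ *ℤ (+ v′ - + 1) *ℤ + flr v′ k) (k * (k ∸ 1))
    × BoundFor 𝒟 0 k 0 1 (+ v′ *ℤ + v′ *ℤ (+ v′ - + 1)) (k * (k ∸ 1)))
proposition2p14 Bs design 𝒟 𝒟-minimal sizes _ = meeting-in-a-point , meeting-in-a-line , disjoint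
  where open Bounds Bs design 𝒟 𝒟-minimal sizes
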